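{- For integers $m\ge2$ and $r\ge 0$, \[\sum_{n=1}^\infty\frac{H_{n+r}}{n^m}=\sum_{n=1}^\infty\frac{H_n}{n^m}+\sum_{l=1}^{m-1}(-1)^{l-1}\zeta(m+1-l)\,H_r^{(l)}+(-1)^{m-1}\sum_{j=1}^r\frac{H_j}{j^m}.\]
   Context: For integers $j\ge1$, $N\ge0$, $H_N^{(j)}=\sum_{i=1}^N i^{ -j}$ (empty sum $=0$) and $H_N=H_N^{(1)}$. $\zeta$ denotes the Riemann zeta function, $\zeta(s)=\sum_{n\ge1}n^{ -s}$. -}

module Defs where

open import Data.Nat as ℕ using (ℕ; zero; suc; _^_; _∸_; _≤_)
open import Data.Nat.Properties using (m^n≢0)
open import Data.Integer using (+_)
open import Data.Rational using (ℚ; 0ℚ; 1ℚ; _+_; _-_; _*_; -_; ∣_∣; _<_; _/_)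
open import Data.Product using (Σ; _×_)

-- 1 / i^j as a rational, for i ≥ 1 (value at i = 0 is irrelevant; set to 0)
recipPow : ℕ → ℕ → ℚ
recipPow zero    j = 0ℚ
recipPow (suc k) j = (+ 1 / (suc k ^ j)) {{m^n≢0 (suc k) j}}

sum1 : ℕ → (ℕ → ℚ) → ℚ
sum1 zero    f = 0ℚ
sum1 (suc N) f = sum1 N f + f (suc N)

H : ℕ → ℕ → ℚ
H j N = sum1 N (λ i → recipPow i j)

negOnePow : ℕ → ℚ
negOnePow zero    = 1ℚ
negOnePow (suc k) = - negOnePow k

partial : (ℕ → ℚ) → ℕ → ℚ
partial a N = sum1 N a

Tendsto0 : (ℕ → ℚ) → Set
Tendsto0 s = ∀ (ε : ℚ) → 0ℚ < ε → Σ ℕ λ N₀ → ∀ N → N₀ ≤ N → ∣ s N ∣ < ε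

-- The series Σ_{n≥1} a n converges (Cauchy criterion on partial sums;
-- its sum is then a well-defined real number)
Converges : (ℕ → ℚ) → Set
Converges a = ∀ (ε : ℚ) → 0ℚ < ε → Σ ℕ λ N₀ → ∀ M N → N₀ ≤ M → N₀ ≤ N →
  ∣ partial a M - partial a N ∣ < ε

lhsTerm : ℕ → ℕ → ℕ → ℚ
lhsTerm m r n = H 1 (n ℕ.+ r) * recipPow n m

eulerTerm : ℕ → ℕ → ℚ
eulerTerm m n = H 1 n * recipPow n m

zetaTerm : ℕ → ℕ → ℚ
zetaTerm s n = recipPow n s

defect : ℕ → ℕ → ℕ → ℚ
defect m r N =
  partial (lhsTerm m r) N
  - partial (eulerTerm m) N
  - sum1 (m ∸ 1) (λ l → negOnePow (l ∸ 1) * partial (zetaTerm (suc m ∸ l)) N * H l r)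
  - negOnePow (m ∸ 1) * sum1 r (λ j → H 1 j * recipPow j m)

-- The heart of the proof is the exact finite identity (defect-closed-form)
--   defect_m(r, N) = (-1)^m Σ_{k=1}^r k^{-m} (H_{N+k} - H_N),
-- proved by induction on N: writing H_{a+r} = H_a + Σ_{k≤r} 1/(a+k), the
-- increment at a = N+1 is the sum over k ≤ r of the partial-fraction expansion
--   a^{-m}/(a+k) = Σ_{l=1}^{m-1} (-1)^{l-1} a^{-(m+1-l)} k^{-l} + (-1)^m k^{-m} (1/(a+k) - 1/a).
-- As 0 ≤ H_{N+k} - H_N ≤ k/(N+1), the defect is at most r²/(N+1) in absolute
-- value and tends to 0.  The three series converge because their terms are
-- bounded by (H_{n+1} + c)/(n+1)², which is dominated by the decrements of the
-- telescoping majorant G_c(n) = 2 (H_n + c + 2)/(n+1); G_c tends to 0 since H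
-- grows sublinearly.
module Submission where

open import Defs
open import Data.Nat using (ℕ; _≤_)
open import Data.Product using (_×_)
open import Data.Nat as ℕ using (zero; suc; _∸_; _^_; s≤s; z≤n)
import Data.Nat.Properties as ℕP
open import Data.Integer as ℤ using (+_; +[1+_])
import Data.Integer.Properties as ℤP
import Data.Integer.Solver as ℤSolver
open import Data.Rational renaming (_≤_ to _≤q_)
open import Data.Rational.Properties
import Data.Rational.Unnormalised as U
import Data.Rational.Unnormalised.Properties as UP
open import Data.Rational.Solver
open +-*-Solver
open import Data.Product using (Σ; _,_; proj₁; proj₂)
open import Data.Sum using (inj₁; inj₂)
open import Relation.Binary.PropositionalEquality

-- Finite sums Σ_{i=1}^N.  Hypotheses about the summands are only required on
-- the summation range, written as indices suc i with i < N.

sum1-cong : ∀ N {f g : ℕ → ℚ} → (∀ i → i ℕ.< N → f (suc i) ≡ g (suc i)) →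
            sum1 N f ≡ sum1 N g
sum1-cong zero    eq = refl
sum1-cong (suc N) eq =
  cong₂ _+_ (sum1-cong N (λ i i<N → eq i (ℕP.m≤n⇒m≤1+n i<N))) (eq N ℕP.≤-refl)

sum1-zero : ∀ N → sum1 N (λ _ → 0ℚ) ≡ 0ℚ
sum1-zero zero    = refl
sum1-zero (suc N) = trans (cong (_+ 0ℚ) (sum1-zero N)) (+-identityʳ 0ℚ)

sum1-+ : ∀ N (f g : ℕ → ℚ) → sum1 N (λ i → f i + g i) ≡ sum1 N f + sum1 N g
sum1-+ zero    f g = sym (+-identityˡ 0ℚ)
sum1-+ (suc N) f g = trans (cong (_+ (f (suc N) + g (suc N))) (sum1-+ N f g))
  (solve 4 (λ a b c d → (a :+ b) :+ (c :+ d) := (a :+ c) :+ (b :+ d)) refl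
     (sum1 N f) (sum1 N g) (f (suc N)) (g (suc N)))

sum1-neg : ∀ N (f : ℕ → ℚ) → sum1 N (λ i → - f i) ≡ - sum1 N f
sum1-neg zero    f = refl
sum1-neg (suc N) f = trans (cong (_+ - f (suc N)) (sum1-neg N f))
  (sym (neg-distrib-+ (sum1 N f) (f (suc N))))

sum1-- : ∀ N (f g : ℕ → ℚ) → sum1 N (λ i → f i - g i) ≡ sum1 N f - sum1 N g
sum1-- N f g = trans (sum1-+ N f (λ i → - g i)) (cong (λ t → sum1 N f + t) (sum1-neg N g))

sum1-*ˡ : ∀ N c (f : ℕ → ℚ) → c * sum1 N f ≡ sum1 N (λ i → c * f i)
sum1-*ˡ zero    c f = *-zeroʳ c
sum1-*ˡ (suc N) c f = trans (*-distribˡ-+ c (sum1 N f) (f (suc N)))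
  (cong (_+ c * f (suc N)) (sum1-*ˡ N c f))

sum1-swap : ∀ A B (f : ℕ → ℕ → ℚ) →
            sum1 A (λ i → sum1 B (λ j → f i j)) ≡ sum1 B (λ j → sum1 A (λ i → f i j))
sum1-swap zero    B f = sym (sum1-zero B)
sum1-swap (suc A) B f = trans (cong (_+ sum1 B (f (suc A))) (sum1-swap A B f))
  (sym (sum1-+ B (λ j → sum1 A (λ i → f i j)) (f (suc A))))

-- The natural number n as a rational, as the sum of n ones; this is the form
-- in which n arises from sums of constants.

nat : ℕ → ℚ
nat n = sum1 n (λ _ → 1ℚ)

sum1-const : ∀ N p → sum1 N (λ _ → p) ≡ nat N * p
sum1-const zero    p = sym (*-zeroˡ p)
sum1-const (suc N) p = trans (cong (_+ p) (sum1-const N p))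
  (solve 2 (λ a p → a :* p :+ p := (a :+ con 1ℚ) :* p) refl (nat N) p)

nat-+ : ∀ a b → nat (a ℕ.+ b) ≡ nat a + nat b
nat-+ zero    b = sym (+-identityˡ (nat b))
nat-+ (suc a) b = begin
  nat (a ℕ.+ b) + 1ℚ ≡⟨ cong (_+ 1ℚ) (nat-+ a b) ⟩
  nat a + nat b + 1ℚ ≡⟨ solve 2 (λ p q → p :+ q :+ con 1ℚ := p :+ con 1ℚ :+ q) refl (nat a) (nat b) ⟩
  nat a + 1ℚ + nat b ∎
  where open ≡-Reasoning

nat-* : ∀ a b → nat (a ℕ.* b) ≡ nat a * nat b
nat-* zero    b = sym (*-zeroˡ (nat b))
nat-* (suc a) b = begin
  nat (b ℕ.+ a ℕ.* b)   ≡⟨ nat-+ b (a ℕ.* b) ⟩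
  nat b + nat (a ℕ.* b) ≡⟨ cong (λ t → nat b + t) (nat-* a b) ⟩
  nat b + nat a * nat b ≡⟨ solve 2 (λ p q → q :+ p :* q := (p :+ con 1ℚ) :* q) refl (nat a) (nat b) ⟩
  (nat a + 1ℚ) * nat b  ∎
  where open ≡-Reasoning

nat-as-fraction : ∀ n → nat n ≡ + n / 1
nat-as-fraction zero    = refl
nat-as-fraction (suc n) = trans (cong (_+ 1ℚ) (nat-as-fraction n)) (toℚᵘ-injective
  (UP.≃-trans (toℚᵘ-homo-+ (+ n / 1) 1ℚ)
  (UP.≃-trans (UP.+-congˡ (U.mkℚᵘ (+ 1) 0) (toℚᵘ-fromℚᵘ (U.mkℚᵘ (+ n) 0)))
  (UP.≃-trans (U.*≡* cross) (UP.≃-sym (toℚᵘ-fromℚᵘ (U.mkℚᵘ (+ suc n) 0)))))))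
  where
  open ℤSolver.+-*-Solver using () renaming (solve to ℤsolve; _:=_ to _:=ℤ_; _:+_ to _:+ℤ_; _:*_ to _:*ℤ_; con to ℤcon)
  cross : ((+ n) ℤ.* + 1 ℤ.+ + 1 ℤ.* + 1) ℤ.* + 1 ≡ (+ 1 ℤ.+ + n) ℤ.* (+ 1 ℤ.* + 1)
  cross = ℤsolve 1 (λ k → ((k :*ℤ ℤcon (+ 1)) :+ℤ ℤcon (+ 1) :*ℤ ℤcon (+ 1)) :*ℤ ℤcon (+ 1)
                         :=ℤ (ℤcon (+ 1) :+ℤ k) :*ℤ (ℤcon (+ 1) :*ℤ ℤcon (+ 1))) refl (+ n)

fraction-inverse : ∀ d .{{_ : ℕ.NonZero d}} → (+ 1 / d) * nat d ≡ 1ℚ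
fraction-inverse (suc d) = trans (cong ((+ 1 / suc d) *_) (nat-as-fraction (suc d))) (toℚᵘ-injective
  (UP.≃-trans (toℚᵘ-homo-* (+ 1 / suc d) (+ suc d / 1))
  (UP.≃-trans (UP.*-cong (toℚᵘ-fromℚᵘ (U.mkℚᵘ (+ 1) d)) (toℚᵘ-fromℚᵘ (U.mkℚᵘ (+ suc d) 0)))
  (U.*≡* cross))))
  where
  open ℤSolver.+-*-Solver using () renaming (solve to ℤsolve; _:=_ to _:=ℤ_; _:*_ to _:*ℤ_; con to ℤcon)
  cross : (+ 1 ℤ.* + suc d) ℤ.* + 1 ≡ + 1 ℤ.* (+ suc d ℤ.* + 1)
  cross = ℤsolve 1 (λ k → (ℤcon (+ 1) :*ℤ k) :*ℤ ℤcon (+ 1) :=ℤ ℤcon (+ 1) :*ℤ (k :*ℤ ℤcon (+ 1))) refl (+ suc d)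

-- Inverses are unique: this is how identities between reciprocals are proved.
inverse-unique : ∀ p q z → p * z ≡ 1ℚ → q * z ≡ 1ℚ → p ≡ q
inverse-unique p q z pz qz = begin
  p           ≡⟨ sym (*-identityʳ p) ⟩
  p * 1ℚ      ≡⟨ cong (p *_) (sym qz) ⟩
  p * (q * z) ≡⟨ solve 3 (λ p q z → p :* (q :* z) := q :* (p :* z)) refl p q z ⟩
  q * (p * z) ≡⟨ cong (q *_) pz ⟩
  q * 1ℚ      ≡⟨ *-identityʳ q ⟩
  q           ∎
  where open ≡-Reasoning

recip : ℕ → ℚ
recip n = recipPow n 1

recipPow-inverse : ∀ n j → recipPow (suc n) j * nat (suc n ^ j) ≡ 1ℚ
recipPow-inverse n j = fraction-inverse (suc n ^ j) {{ℕP.m^n≢0 (suc n) j}}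

recip-inverse : ∀ n → recip (suc n) * nat (suc n) ≡ 1ℚ
recip-inverse n = trans (cong (λ t → recip (suc n) * nat t) (sym (ℕP.*-identityʳ (suc n))))
                        (recipPow-inverse n 1)

product-inverse : ∀ p q u v → p * u ≡ 1ℚ → q * v ≡ 1ℚ → p * q * (u * v) ≡ 1ℚ
product-inverse p q u v pu qv = begin
  p * q * (u * v)   ≡⟨ solve 4 (λ p q u v → p :* q :* (u :* v) := (p :* u) :* (q :* v)) refl p q u v ⟩
  (p * u) * (q * v) ≡⟨ cong₂ _*_ pu qv ⟩
  1ℚ * 1ℚ           ≡⟨ *-identityˡ 1ℚ ⟩
  1ℚ                ∎
  where open ≡-Reasoning

recipPow-suc : ∀ n j → recipPow n (suc j) ≡ recip n * recipPow n j
recipPow-suc zero    j = sym (*-zeroˡ 0ℚ)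
recipPow-suc (suc n) j = inverse-unique _ _ (nat (suc n ^ suc j)) (recipPow-inverse n (suc j))
  (trans (cong (recip (suc n) * recipPow (suc n) j *_) (nat-* (suc n) (suc n ^ j)))
         (product-inverse (recip (suc n)) (recipPow (suc n) j) (nat (suc n)) (nat (suc n ^ j))
                          (recip-inverse n) (recipPow-inverse n j)))

recip-* : ∀ a b → recip (suc a ℕ.* suc b) ≡ recip (suc a) * recip (suc b)
recip-* a b = inverse-unique _ _ (nat (suc a ℕ.* suc b)) (recip-inverse (b ℕ.+ a ℕ.* suc b))
  (trans (cong (recip (suc a) * recip (suc b) *_) (nat-* (suc a) (suc b)))
         (product-inverse (recip (suc a)) (recip (suc b)) (nat (suc a)) (nat (suc b))
                          (recip-inverse a) (recip-inverse b)))

partial-fraction : ∀ a b → recip (suc a) * recip (suc b)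
                         ≡ recip (suc a ℕ.+ suc b) * (recip (suc a) + recip (suc b))
partial-fraction a b = inverse-unique _ _ (nat A * nat B)
  (product-inverse ra rb (nat A) (nat B) (recip-inverse a) (recip-inverse b))
  (begin
    c * (ra + rb) * (nat A * nat B)
      ≡⟨ solve 5 (λ c p q u v → c :* (p :+ q) :* (u :* v) := c :* ((p :* u) :* v :+ (q :* v) :* u)) refl
           c ra rb (nat A) (nat B) ⟩
    c * ((ra * nat A) * nat B + (rb * nat B) * nat A)
      ≡⟨ cong₂ (λ u v → c * (u * nat B + v * nat A)) (recip-inverse a) (recip-inverse b) ⟩
    c * (1ℚ * nat B + 1ℚ * nat A)
      ≡⟨ solve 3 (λ c u v → c :* (con 1ℚ :* v :+ con 1ℚ :* u) := c :* (u :+ v)) refl c (nat A) (nat B) ⟩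
    c * (nat A + nat B)
      ≡⟨ cong (c *_) (sym (nat-+ A B)) ⟩
    c * nat (A ℕ.+ B)
      ≡⟨ recip-inverse (a ℕ.+ B) ⟩
    1ℚ ∎)
  where
  open ≡-Reasoning
  A = suc a
  B = suc b
  c = recip (A ℕ.+ B)
  ra = recip A
  rb = recip B

recip-step : ∀ n → recip (suc n) ≡ recip (suc n) * recip (suc (suc n)) + recip (suc (suc n))
recip-step n = begin
  recip (suc n)                      ≡⟨ sym (*-identityʳ _) ⟩
  recip (suc n) * recip 1            ≡⟨ partial-fraction n 0 ⟩
  recip (suc n ℕ.+ 1) * (recip (suc n) + 1ℚ)
    ≡⟨ cong (λ t → recip (suc t) * (recip (suc n) + 1ℚ)) (ℕP.+-comm n 1) ⟩
  y * (recip (suc n) + 1ℚ)           ≡⟨ solve 2 (λ a b → b :* (a :+ con 1ℚ) := a :* b :+ b) refl (recip (suc n)) y ⟩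
  recip (suc n) * y + y              ∎
  where
  open ≡-Reasoning
  y = recip (suc (suc n))

H-shift : ∀ a r → H 1 (a ℕ.+ r) ≡ H 1 a + sum1 r (λ k → recip (a ℕ.+ k))
H-shift a zero = trans (cong (H 1) (ℕP.+-identityʳ a)) (sym (+-identityʳ (H 1 a)))
H-shift a (suc r) = begin
  H 1 (a ℕ.+ suc r)                                    ≡⟨ cong (H 1) (ℕP.+-suc a r) ⟩
  H 1 (a ℕ.+ r) + recip (suc (a ℕ.+ r))                ≡⟨ cong₂ _+_ (H-shift a r) (cong recip (sym (ℕP.+-suc a r))) ⟩
  H 1 a + sum1 r (λ k → recip (a ℕ.+ k)) + recip (a ℕ.+ suc r) ≡⟨ +-assoc (H 1 a) _ _ ⟩
  H 1 a + (sum1 r (λ k → recip (a ℕ.+ k)) + recip (a ℕ.+ suc r)) ∎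
  where open ≡-Reasoning

H-increment : ∀ N k → H 1 (N ℕ.+ k) - H 1 N ≡ sum1 k (λ i → recip (N ℕ.+ i))
H-increment N k = trans (cong (_- H 1 N) (H-shift N k))
  (solve 2 (λ a b → a :+ b :- a := b) refl (H 1 N) _)

-- The truncated expansion  Σ_{l=1}^{m} (-1)^{l-1} a^{-(m+2-l)} k^{-l}
-- of 1/(a^{m+1} (a+k)) in powers of 1/k.
expansion : ℕ → ℕ → ℕ → ℚ
expansion a k m = sum1 m (λ l → negOnePow (l ∸ 1) * recipPow a (suc (suc m) ∸ l) * recipPow k l)

expansion-suc : ∀ a k m → expansion a k (suc m)
              ≡ recip a * expansion a k m + negOnePow m * (recip a * recip a) * recipPow k (suc m)
expansion-suc a k m = cong₂ _+_
  (trans (sum1-cong m (λ i i<m → trans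
      (cong (λ e → negOnePow i * recipPow a e * recipPow k (suc i))
            (ℕP.+-∸-assoc 1 (ℕP.m<n⇒m≤1+n i<m)))
      (trans (cong (λ t → negOnePow i * t * recipPow k (suc i)) (recipPow-suc a (suc (suc m) ∸ suc i)))
        (solve 4 (λ p q r t → p :* (q :* r) :* t := q :* (p :* r :* t)) refl
           (negOnePow i) (recip a) (recipPow a (suc (suc m) ∸ suc i)) (recipPow k (suc i))))))
    (sym (sum1-*ˡ m (recip a) _)))
  (trans (cong (λ e → negOnePow m * recipPow a e * recipPow k (suc m)) (ℕP.m+n∸n≡m 2 m))
         (cong (λ t → negOnePow m * t * recipPow k (suc m)) (recipPow-suc a 1)))

expansion-remainder : ∀ a k m →
  recipPow (suc a) (suc m) * recip (suc a ℕ.+ suc k) - expansion (suc a) (suc k) m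
  ≡ negOnePow (suc m) * recipPow (suc k) (suc m) * (recip (suc a ℕ.+ suc k) - recip (suc a))
expansion-remainder a k zero = begin
  ra * c - 0ℚ                ≡⟨ solve 3 (λ a b c → a :* c :- con 0ℚ := (:- (b :* c)) :+ c :* (a :+ b)) refl ra rk c ⟩
  - (rk * c) + c * (ra + rk) ≡⟨ cong (λ t → - (rk * c) + t) (sym (partial-fraction a k)) ⟩
  - (rk * c) + ra * rk       ≡⟨ solve 3 (λ a b c → (:- (b :* c)) :+ a :* b := (:- con 1ℚ) :* b :* (c :- a)) refl ra rk c ⟩
  - 1ℚ * rk * (c - ra)       ∎
  where
  open ≡-Reasoning
  c = recip (suc a ℕ.+ suc k)
  ra = recip (suc a)
  rk = recip (suc k)
expansion-remainder a k (suc m) = begin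
  recipPow (suc a) (suc (suc m)) * c - expansion (suc a) (suc k) (suc m)
    ≡⟨ cong₂ (λ u v → u * c - v) (recipPow-suc (suc a) (suc m)) (expansion-suc (suc a) (suc k) m) ⟩
  ra * Ra * c - (ra * P + σ * (ra * ra) * B)
    ≡⟨ solve 6 (λ ra Ra c p σ B → ra :* Ra :* c :- (ra :* p :+ σ :* (ra :* ra) :* B)
                               := ra :* (Ra :* c :- p) :- σ :* (ra :* ra) :* B) refl ra Ra c P σ B ⟩
  ra * (Ra * c - P) - σ * (ra * ra) * B
    ≡⟨ cong (λ t → ra * t - σ * (ra * ra) * B) (expansion-remainder a k m) ⟩
  ra * (- σ * B * (c - ra)) - σ * (ra * ra) * B
    ≡⟨ solve 5 (λ ra rk c σ B → ra :* (:- σ :* B :* (c :- ra)) :- σ :* (ra :* ra) :* B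
                             := σ :* B :* (rk :* c :- c :* (ra :+ rk))) refl ra rk c σ B ⟩
  σ * B * (rk * c - c * (ra + rk))
    ≡⟨ cong (λ t → σ * B * (rk * c - t)) (sym (partial-fraction a k)) ⟩
  σ * B * (rk * c - ra * rk)
    ≡⟨ solve 5 (λ ra rk c σ B → σ :* B :* (rk :* c :- ra :* rk) := :- (:- σ) :* (rk :* B) :* (c :- ra)) refl ra rk c σ B ⟩
  - - σ * (rk * B) * (c - ra)
    ≡⟨ cong (λ t → - - σ * t * (c - ra)) (sym (recipPow-suc (suc k) (suc m))) ⟩
  negOnePow (suc (suc m)) * recipPow (suc k) (suc (suc m)) * (c - ra) ∎
  where
  open ≡-Reasoning
  c = recip (suc a ℕ.+ suc k)
  ra = recip (suc a)
  rk = recip (suc k)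
  σ = negOnePow m
  Ra = recipPow (suc a) (suc m)
  B = recipPow (suc k) (suc m)
  P = expansion (suc a) (suc k) m

-- S_m(r, N) = Σ_{k=1}^r k^{-m} (H_{N+k} - H_N): the defect in closed form.
shiftedSum : ℕ → ℕ → ℕ → ℚ
shiftedSum m r N = sum1 r (λ k → recipPow k m * (H 1 (N ℕ.+ k) - H 1 N))

shiftedSum-suc : ∀ m r N → shiftedSum m r (suc N)
  ≡ shiftedSum m r N + sum1 r (λ k → recipPow k m * (recip (suc N ℕ.+ k) - recip (suc N)))
shiftedSum-suc m r N = trans
  (sum1-cong r (λ k _ → solve 5 (λ R h' c h x → R :* ((h' :+ c) :- (h :+ x)) := R :* (h' :- h) :+ R :* (c :- x)) refl
      (recipPow (suc k) m) (H 1 (N ℕ.+ suc k)) (recip (suc N ℕ.+ suc k)) (H 1 N) (recip (suc N))))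
  (sum1-+ r _ _)

defect-zero : ∀ m' r → defect (suc m') r 0 ≡ negOnePow (suc m') * shiftedSum (suc m') r 0
defect-zero m' r = begin
  0ℚ - 0ℚ - sum1 m' (λ l → negOnePow (l ∸ 1) * 0ℚ * H l r) - σ * E
    ≡⟨ cong (λ t → 0ℚ - 0ℚ - t - σ * E)
         (trans (sum1-cong m' (λ l _ → solve 2 (λ a b → a :* con 0ℚ :* b := con 0ℚ) refl (negOnePow l) (H (suc l) r)))
                (sum1-zero m')) ⟩
  0ℚ - 0ℚ - 0ℚ - σ * E
    ≡⟨ cong (λ t → 0ℚ - 0ℚ - 0ℚ - σ * t)
         (sum1-cong r (λ j _ → solve 2 (λ a b → a :* b := b :* (a :- con 0ℚ)) refl (H 1 (suc j)) (recipPow (suc j) (suc m')))) ⟩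
  0ℚ - 0ℚ - 0ℚ - σ * S
    ≡⟨ solve 2 (λ a b → con 0ℚ :- con 0ℚ :- con 0ℚ :- a :* b := (:- a) :* b) refl σ S ⟩
  - σ * S ∎
  where
  open ≡-Reasoning
  σ = negOnePow m'
  E = sum1 r (λ j → H 1 j * recipPow j (suc m'))
  S = shiftedSum (suc m') r 0

-- The (N+1)-st term of the defect series, with m = m'+1.
defectTerm : ℕ → ℕ → ℕ → ℚ
defectTerm m' r N = lhsTerm (suc m') r (suc N) - eulerTerm (suc m') (suc N)
  - sum1 m' (λ l → negOnePow (l ∸ 1) * recipPow (suc N) (suc (suc m') ∸ l) * H l r)

defect-suc : ∀ m' r N → defect (suc m') r (suc N) ≡ defect (suc m') r N + defectTerm m' r N
defect-suc m' r N = begin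
  (pL + L) - (pE + e) - sum1 m' (λ l → σ l * (Z l + z l) * H l r) - τ * Eᵣ
    ≡⟨ cong (λ t → (pL + L) - (pE + e) - t - τ * Eᵣ)
         (trans (sum1-cong m' (λ l _ → solve 4 (λ a b c d → a :* (b :+ c) :* d := a :* b :* d :+ a :* c :* d) refl
                                   (σ (suc l)) (Z (suc l)) (z (suc l)) (H (suc l) r)))
                (sum1-+ m' _ _)) ⟩
  (pL + L) - (pE + e) - (Zs + Q) - τ * Eᵣ
    ≡⟨ solve 8 (λ pL L pE e Zs Q τ Eᵣ → (pL :+ L) :- (pE :+ e) :- (Zs :+ Q) :- τ :* Eᵣ
                                   := (pL :- pE :- Zs :- τ :* Eᵣ) :+ (L :- e :- Q)) refl pL L pE e Zs Q τ Eᵣ ⟩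
  (pL - pE - Zs - τ * Eᵣ) + (L - e - Q) ∎
  where
  open ≡-Reasoning
  σ = λ l → negOnePow (l ∸ 1)
  pL = partial (lhsTerm (suc m') r) N
  L = lhsTerm (suc m') r (suc N)
  pE = partial (eulerTerm (suc m')) N
  e = eulerTerm (suc m') (suc N)
  Z = λ l → partial (zetaTerm (suc (suc m') ∸ l)) N
  z = λ l → recipPow (suc N) (suc (suc m') ∸ l)
  Zs = sum1 m' (λ l → σ l * Z l * H l r)
  Q = sum1 m' (λ l → σ l * z l * H l r)
  τ = negOnePow m'
  Eᵣ = sum1 r (λ j → H 1 j * recipPow j (suc m'))

-- The defect term equals the increment of (-1)^m S_m(r, ·): expand H_{N+1+r}
-- by H-shift, exchange the two finite sums, and apply expansion-remainder to
-- each k.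
defectTerm-closed-form : ∀ m' r N → defectTerm m' r N
  ≡ negOnePow (suc m') * sum1 r (λ k → recipPow k (suc m') * (recip (suc N ℕ.+ k) - recip (suc N)))
defectTerm-closed-form m' r N = begin
  H 1 (a ℕ.+ r) * Ra - H 1 a * Ra - Q
    ≡⟨ cong (λ t → t * Ra - H 1 a * Ra - Q) (H-shift a r) ⟩
  (H 1 a + X) * Ra - H 1 a * Ra - Q
    ≡⟨ solve 4 (λ h X R Q → (h :+ X) :* R :- h :* R :- Q := R :* X :- Q) refl (H 1 a) X Ra Q ⟩
  Ra * X - Q
    ≡⟨ cong₂ _-_ (sum1-*ˡ r Ra _) Q-exchanged ⟩
  sum1 r (λ k → Ra * recip (a ℕ.+ k)) - sum1 r (λ k → expansion a k m')
    ≡⟨ sym (sum1-- r _ _) ⟩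
  sum1 r (λ k → Ra * recip (a ℕ.+ k) - expansion a k m')
    ≡⟨ sum1-cong r (λ k _ → expansion-remainder N k m') ⟩
  sum1 r (λ k → negOnePow m * recipPow k m * (recip (a ℕ.+ k) - recip a))
    ≡⟨ trans (sum1-cong r (λ k _ → *-assoc (negOnePow m) _ _)) (sym (sum1-*ˡ r (negOnePow m) _)) ⟩
  negOnePow m * sum1 r (λ k → recipPow k m * (recip (a ℕ.+ k) - recip a)) ∎
  where
  open ≡-Reasoning
  m = suc m'
  a = suc N
  Ra = recipPow a m
  X = sum1 r (λ k → recip (a ℕ.+ k))
  Q = sum1 m' (λ l → negOnePow (l ∸ 1) * recipPow a (suc m ∸ l) * H l r)
  Q-exchanged : Q ≡ sum1 r (λ k → expansion a k m')
  Q-exchanged = begin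
    Q ≡⟨ sum1-cong m' (λ l _ → sum1-*ˡ r (negOnePow l * recipPow a (suc m ∸ suc l)) _) ⟩
    sum1 m' (λ l → sum1 r (λ k → negOnePow (l ∸ 1) * recipPow a (suc m ∸ l) * recipPow k l)) ≡⟨ sum1-swap m' r _ ⟩
    sum1 r (λ k → expansion a k m') ∎

defect-closed-form : ∀ m' r N → defect (suc m') r N ≡ negOnePow (suc m') * shiftedSum (suc m') r N
defect-closed-form m' r zero    = defect-zero m' r
defect-closed-form m' r (suc N) = begin
  defect (suc m') r (suc N)
    ≡⟨ defect-suc m' r N ⟩
  defect (suc m') r N + defectTerm m' r N
    ≡⟨ cong₂ _+_ (defect-closed-form m' r N) (defectTerm-closed-form m' r N) ⟩
  σ * shiftedSum (suc m') r N + σ * D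
    ≡⟨ sym (*-distribˡ-+ σ _ _) ⟩
  σ * (shiftedSum (suc m') r N + D)
    ≡⟨ cong (σ *_) (sym (shiftedSum-suc (suc m') r N)) ⟩
  σ * shiftedSum (suc m') r (suc N) ∎
  where
  open ≡-Reasoning
  σ = negOnePow (suc m')
  D = sum1 r (λ k → recipPow k (suc m') * (recip (suc N ℕ.+ k) - recip (suc N)))

diff-nonneg : ∀ {p q} → p ≤q q → 0ℚ ≤q q - p
diff-nonneg {p} {q} le = subst (_≤q q - p) (+-inverseʳ p) (+-mono-≤ le (≤-refl { - p}))

nonneg-diff : ∀ {p q} → 0ℚ ≤q q - p → p ≤q q
nonneg-diff {p} {q} le = subst₂ _≤q_ (+-identityˡ p) (solve 2 (λ p q → q :- p :+ p := q) refl p q)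
  (+-mono-≤ le (≤-refl {p}))

≤-by-diff : ∀ {p q} w → q - p ≡ w → 0ℚ ≤q w → p ≤q q
≤-by-diff w eq 0≤w = nonneg-diff (subst (0ℚ ≤q_) (sym eq) 0≤w)

nonneg-+ : ∀ {p q} → 0ℚ ≤q p → 0ℚ ≤q q → 0ℚ ≤q p + q
nonneg-+ {p} {q} 0≤p 0≤q = subst (_≤q p + q) (+-identityˡ 0ℚ) (+-mono-≤ 0≤p 0≤q)

nonneg-* : ∀ {p q} → 0ℚ ≤q p → 0ℚ ≤q q → 0ℚ ≤q p * q
nonneg-* {p} {q} 0≤p 0≤q =
  nonNegative⁻¹ (p * q) {{nonNeg*nonNeg⇒nonNeg p {{nonNegative 0≤p}} q {{nonNegative 0≤q}}}}

*-mono-nonneg : ∀ {p p' q q'} → 0ℚ ≤q p → p ≤q p' → 0ℚ ≤q q → q ≤q q' → p * q ≤q p' * q'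
*-mono-nonneg {p} {p'} {q} {q'} 0≤p p≤p' 0≤q q≤q' =
  ≤-trans (*-monoʳ-≤-nonNeg q {{nonNegative 0≤q}} p≤p')
          (*-monoˡ-≤-nonNeg p' {{nonNegative (≤-trans 0≤p p≤p')}} q≤q')

0≤1 : 0ℚ ≤q 1ℚ
0≤1 = nonNegative⁻¹ 1ℚ

sum1-nonneg : ∀ N (f : ℕ → ℚ) → (∀ i → i ℕ.< N → 0ℚ ≤q f (suc i)) → 0ℚ ≤q sum1 N f
sum1-nonneg zero    f h = ≤-refl
sum1-nonneg (suc N) f h = nonneg-+ (sum1-nonneg N f (λ i i<N → h i (ℕP.m≤n⇒m≤1+n i<N))) (h N ℕP.≤-refl)

sum1-mono : ∀ N (f g : ℕ → ℚ) → (∀ i → i ℕ.< N → f (suc i) ≤q g (suc i)) → sum1 N f ≤q sum1 N g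
sum1-mono zero    f g h = ≤-refl
sum1-mono (suc N) f g h = +-mono-≤ (sum1-mono N f g (λ i i<N → h i (ℕP.m≤n⇒m≤1+n i<N))) (h N ℕP.≤-refl)

nat-nonneg : ∀ n → 0ℚ ≤q nat n
nat-nonneg n = sum1-nonneg n _ (λ _ _ → 0≤1)

nat-mono : ∀ {a b} → a ℕ.≤ b → nat a ≤q nat b
nat-mono {a} {b} a≤b = subst (λ t → nat a ≤q nat t) (ℕP.m∸n+n≡m a≤b)
  (subst (nat a ≤q_) (sym (nat-+ (b ∸ a) a))
    (subst (_≤q nat (b ∸ a) + nat a) (+-identityˡ (nat a)) (+-mono-≤ (nat-nonneg (b ∸ a)) (≤-refl {nat a}))))

recipPow-nonneg : ∀ n j → 0ℚ ≤q recipPow n j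
recipPow-nonneg zero    j = ≤-refl
recipPow-nonneg (suc n) j = nonNegative⁻¹ _ {{normalize-nonNeg 1 (suc n ^ j) {{ℕP.m^n≢0 (suc n) j}}}}

recip-nonneg : ∀ n → 0ℚ ≤q recip n
recip-nonneg n = recipPow-nonneg n 1

recip≤1 : ∀ n → recip (suc n) ≤q 1ℚ
recip≤1 n = ≤-by-diff (r * nat n)
  (begin
    1ℚ - r              ≡⟨ cong (_- r) (sym (recip-inverse n)) ⟩
    r * (nat n + 1ℚ) - r ≡⟨ solve 2 (λ a b → a :* (b :+ con 1ℚ) :- a := a :* b) refl r (nat n) ⟩
    r * nat n           ∎)
  (nonneg-* (recip-nonneg (suc n)) (nat-nonneg n))
  where
  open ≡-Reasoning
  r = recip (suc n)

-- 1/n is antitone: 1/(n+1) - 1/(n+2) = 1/((n+1)(n+2)) ≥ 0.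
recip-antitone : ∀ {N M} → N ℕ.≤ M → recip (suc M) ≤q recip (suc N)
recip-antitone N≤M = go (ℕP.≤⇒≤′ N≤M)
  where
  decreasing : ∀ n → recip (suc (suc n)) ≤q recip (suc n)
  decreasing n = ≤-by-diff (recip (suc n) * recip (suc (suc n)))
    (trans (cong (_- recip (suc (suc n))) (recip-step n))
           (solve 2 (λ a b → a :+ b :- b := a) refl (recip (suc n) * recip (suc (suc n))) (recip (suc (suc n)))))
    (nonneg-* (recip-nonneg (suc n)) (recip-nonneg (suc (suc n))))
  go : ∀ {N M} → N ℕ.≤′ M → recip (suc M) ≤q recip (suc N)
  go (ℕ.≤′-reflexive refl)         = ≤-refl
  go {M = suc M} (ℕ.≤′-step N≤′M) = ≤-trans (decreasing M) (go N≤′M)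

recipPow-suc-≤ : ∀ n j → recipPow (suc n) (suc j) ≤q recipPow (suc n) j
recipPow-suc-≤ n j = subst (_≤q recipPow (suc n) j) (sym (recipPow-suc (suc n) j))
  (subst (recip (suc n) * recipPow (suc n) j ≤q_) (*-identityˡ _)
    (*-monoʳ-≤-nonNeg (recipPow (suc n) j) {{nonNegative (recipPow-nonneg (suc n) j)}} (recip≤1 n)))

recipPow≤1 : ∀ n j → recipPow (suc n) (suc j) ≤q 1ℚ
recipPow≤1 n zero    = recip≤1 n
recipPow≤1 n (suc j) = ≤-trans (recipPow-suc-≤ n (suc j)) (recipPow≤1 n j)

recipPow≤recip² : ∀ n t → recipPow (suc n) (suc (suc t)) ≤q recip (suc n) * recip (suc n)
recipPow≤recip² n zero    = ≤-reflexive (recipPow-suc (suc n) 1)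
recipPow≤recip² n (suc t) = ≤-trans (recipPow-suc-≤ n (suc (suc t))) (recipPow≤recip² n t)

H-nonneg : ∀ j n → 0ℚ ≤q H j n
H-nonneg j n = sum1-nonneg n _ (λ i _ → recipPow-nonneg (suc i) j)

H≤nat : ∀ n → H 1 n ≤q nat n
H≤nat n = sum1-mono n _ _ (λ i _ → recip≤1 i)

H-increment-nonneg : ∀ N k → 0ℚ ≤q H 1 (N ℕ.+ k) - H 1 N
H-increment-nonneg N k = subst (0ℚ ≤q_) (sym (H-increment N k))
  (sum1-nonneg k _ (λ i _ → recip-nonneg (N ℕ.+ suc i)))

H-increment-≤ : ∀ N k → H 1 (N ℕ.+ k) - H 1 N ≤q nat k * recip (suc N)
H-increment-≤ N k = subst₂ _≤q_ (sym (H-increment N k)) (sum1-const k (recip (suc N)))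
  (sum1-mono k _ _ (λ i _ → subst (λ t → recip t ≤q recip (suc N)) (sym (ℕP.+-suc N i))
                                  (recip-antitone (ℕP.m≤m+n N i))))

H-shift-≤ : ∀ n r → H 1 (n ℕ.+ r) ≤q H 1 n + nat r
H-shift-≤ n r = subst (_≤q H 1 n + nat r) (sym (H-shift n r))
  (+-mono-≤ (≤-refl {H 1 n}) (sum1-mono r _ _ (λ i _ → subst (λ t → recip t ≤q 1ℚ) (sym (ℕP.+-suc n i)) (recip≤1 (n ℕ.+ i)))))

-- H grows sublinearly:  H_{K+K²} ≤ H_K + K²/K ≤ 2K.
H-sublinear : ∀ K' → H 1 (suc K' ℕ.+ suc K' ℕ.* suc K') ≤q nat (suc K') + nat (suc K')
H-sublinear K' = begin
  H 1 (K ℕ.+ K ℕ.* K)                         ≤⟨ H-shift-≤′ ⟩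
  nat K + nat (K ℕ.* K) * recip K              ≡⟨ cong (λ t → nat K + t * recip K) (nat-* K K) ⟩
  nat K + nat K * nat K * recip K              ≡⟨ cong (λ t → nat K + t) (trans (*-assoc (nat K) _ _)
                                                   (trans (cong (nat K *_) (*-comm (nat K) (recip K)))
                                                   (trans (cong (nat K *_) (recip-inverse K')) (*-identityʳ (nat K))))) ⟩
  nat K + nat K                                ∎
  where
  open ≤-Reasoning
  K = suc K'
  H-shift-≤′ : H 1 (K ℕ.+ K ℕ.* K) ≤q nat K + nat (K ℕ.* K) * recip K
  H-shift-≤′ = subst (_≤q nat K + nat (K ℕ.* K) * recip K) (sym (H-shift K (K ℕ.* K)))
    (+-mono-≤ (H≤nat K) (subst (sum1 (K ℕ.* K) (λ i → recip (K ℕ.+ i)) ≤q_) (sum1-const (K ℕ.* K) (recip K))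
      (sum1-mono (K ℕ.* K) _ _ (λ i _ → recip-antitone (ℕP.m≤m+n K' (suc i))))))

archimedean : ∀ ε → 0ℚ < ε → Σ ℕ λ q → recip (suc q) < ε
archimedean ε 0<ε = go ε (positive 0<ε)
  where
  go : ∀ ε → Positive ε → Σ ℕ λ q → recip (suc q) < ε
  go (mkℚ +[1+ n ] d c) _ = suc d , toℚᵘ-cancel-<
    (UP.<-respˡ-≃ (UP.≃-sym (toℚᵘ-fromℚᵘ (U.mkℚᵘ (+ 1) (suc d ℕ.* 1)))) (U.*<* cross))
    where
    cross : + 1 ℤ.* + suc d ℤ.< +[1+ n ] ℤ.* + suc (suc d ℕ.* 1)
    cross rewrite ℤP.*-identityˡ (+ suc d) | ℕP.*-identityʳ d | sym (ℤP.pos-* (suc n) (suc (suc d))) =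
      ℤ.+<+ (ℕP.<-≤-trans (ℕP.n<1+n (suc d)) (ℕP.m≤m+n (suc (suc d)) (n ℕ.* suc (suc d))))

-- Comparison with a telescoping series: if 0 ≤ a_{n+1} ≤ G_n - G_{n+1} for a
-- nonnegative G taking arbitrarily small values, then Σ a_n converges, since
-- each block Σ_{N<n≤M} a_n lies between 0 and G_N - G_M ≤ G_N.
module Telescoping (a G : ℕ → ℚ)
  (a-nonneg : ∀ n → 0ℚ ≤q a (suc n))
  (G-nonneg : ∀ n → 0ℚ ≤q G n)
  (a≤ΔG : ∀ n → a (suc n) ≤q G n - G (suc n))
  (G-small : ∀ ε → 0ℚ < ε → Σ ℕ λ N → G N < ε) where

  block : ℕ → ℕ → ℚ
  block j N = partial a (j ℕ.+ N) - partial a N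

  block-bounds : ∀ j N → 0ℚ ≤q block j N × block j N ≤q G N - G (j ℕ.+ N)
  block-bounds zero N =
      subst (0ℚ ≤q_) (sym (+-inverseʳ (partial a N))) ≤-refl
    , subst₂ _≤q_ (sym (+-inverseʳ (partial a N))) (sym (+-inverseʳ (G N))) ≤-refl
  block-bounds (suc j) N =
      subst (0ℚ ≤q_) (sym split) (nonneg-+ (proj₁ ih) (a-nonneg (j ℕ.+ N)))
    , subst₂ _≤q_ (sym split)
        (solve 3 (λ p q r → p :- q :+ (q :- r) := p :- r) refl (G N) (G (j ℕ.+ N)) (G (suc (j ℕ.+ N))))
        (+-mono-≤ (proj₂ ih) (a≤ΔG (j ℕ.+ N)))
    where
    ih = block-bounds j N
    split : block (suc j) N ≡ block j N + a (suc (j ℕ.+ N))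
    split = solve 3 (λ p q r → p :+ r :- q := p :- q :+ r) refl (partial a (j ℕ.+ N)) (partial a N) (a (suc (j ℕ.+ N)))

  G-antitone : ∀ {N M} → N ℕ.≤ M → G M ≤q G N
  G-antitone {N} {M} N≤M = subst (λ t → G t ≤q G N) (ℕP.m∸n+n≡m N≤M)
    (nonneg-diff (≤-trans (proj₁ (block-bounds (M ∸ N) N)) (proj₂ (block-bounds (M ∸ N) N))))

  ordered-block-≤ : ∀ {N₀ N M} → N₀ ℕ.≤ N → N ℕ.≤ M → ∣ partial a M - partial a N ∣ ≤q G N₀
  ordered-block-≤ {N₀} {N} {M} N₀≤N N≤M = subst (λ t → ∣ partial a t - partial a N ∣ ≤q G N₀) (ℕP.m∸n+n≡m N≤M)
    (subst (_≤q G N₀) (sym (0≤p⇒∣p∣≡p (proj₁ bounds)))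
      (≤-trans (proj₂ bounds)
        (≤-trans (≤-by-diff (G (M ∸ N ℕ.+ N)) (solve 2 (λ p q → p :- (p :- q) := q) refl (G N) (G (M ∸ N ℕ.+ N)))
                            (G-nonneg (M ∸ N ℕ.+ N)))
                 (G-antitone N₀≤N))))
    where bounds = block-bounds (M ∸ N) N

  block-≤ : ∀ {N₀ N M} → N₀ ℕ.≤ N → N₀ ℕ.≤ M → ∣ partial a M - partial a N ∣ ≤q G N₀
  block-≤ {N₀} {N} {M} N₀≤N N₀≤M with ℕP.≤-total N M
  ... | inj₁ N≤M = ordered-block-≤ N₀≤N N≤M
  ... | inj₂ M≤N = subst (_≤q G N₀)
          (trans (sym (∣-p∣≡∣p∣ (partial a N - partial a M)))
                 (cong ∣_∣ (solve 2 (λ p q → :- (p :- q) := q :- p) refl (partial a N) (partial a M))))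
          (ordered-block-≤ N₀≤M M≤N)

  converges : Converges a
  converges ε 0<ε = N₀ , λ M N N₀≤M N₀≤N → ≤-<-trans (block-≤ N₀≤N N₀≤M) GN₀<ε
    where
    N₀ = proj₁ (G-small ε 0<ε)
    GN₀<ε = proj₂ (G-small ε 0<ε)

recip-beyond-square : ∀ K' → recip (suc (suc K' ℕ.+ suc K' ℕ.* suc K')) ≤q recip (suc K') * recip (suc K')
recip-beyond-square K' = subst (recip (suc (K ℕ.+ K ℕ.* K)) ≤q_) (recip-* K' K')
  (recip-antitone (ℕP.≤-trans (ℕP.n≤1+n (K' ℕ.+ K' ℕ.* K)) (ℕP.m≤n+m (K ℕ.* K) K)))
  where K = suc K'

nat-recip-cancel : ∀ d' L' → nat (suc d') * recip (suc d' ℕ.* suc L') ≡ recip (suc L')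
nat-recip-cancel d' L' = inverse-unique _ _ (nat (suc L'))
  (begin
    nat D * recip (D ℕ.* L) * nat L ≡⟨ solve 3 (λ a b c → a :* b :* c := b :* (a :* c)) refl (nat D) (recip (D ℕ.* L)) (nat L) ⟩
    recip (D ℕ.* L) * (nat D * nat L) ≡⟨ cong (recip (D ℕ.* L) *_) (sym (nat-* D L)) ⟩
    recip (D ℕ.* L) * nat (D ℕ.* L)   ≡⟨ recip-inverse (L' ℕ.+ d' ℕ.* L) ⟩
    1ℚ ∎)
  (recip-inverse L')
  where
  open ≡-Reasoning
  D = suc d'
  L = suc L'

majorant : ℕ → ℕ → ℚ
majorant c n = (1ℚ + 1ℚ) * (H 1 n + nat (2 ℕ.+ c)) * recip (suc n)

majorant-nonneg : ∀ c n → 0ℚ ≤q majorant c n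
majorant-nonneg c n = nonneg-* (nonneg-* (nonneg-+ 0≤1 0≤1) (nonneg-+ (H-nonneg 1 n) (nat-nonneg (2 ℕ.+ c))))
                               (recip-nonneg (suc n))

-- With h = H_n, X = 1/(n+1), Y = 1/(n+2) and X - XY - Y = 0 (recip-step),
--   G_n - G_{n+1} - (h + X + c) X² = (h + c + 1) X Y (1 - X) + X² (1 - X) ≥ 0.
majorant-decrement : ∀ c n → (H 1 (suc n) + nat c) * (recip (suc n) * recip (suc n))
                           ≤q majorant c n - majorant c (suc n)
majorant-decrement c n = ≤-by-diff slack
  (begin
    majorant c n - majorant c (suc n) - (h + X + C) * (X * X)
      ≡⟨ solve 4 (λ h C X Y → (con 1ℚ :+ con 1ℚ) :* (h :+ (C :+ con 1ℚ :+ con 1ℚ)) :* X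
                             :- (con 1ℚ :+ con 1ℚ) :* (h :+ X :+ (C :+ con 1ℚ :+ con 1ℚ)) :* Y :- (h :+ X :+ C) :* (X :* X)
              := (h :+ C :+ con 1ℚ) :* X :* Y :* (con 1ℚ :- X) :+ X :* X :* (con 1ℚ :- X)
                 :+ ((con 1ℚ :+ con 1ℚ) :* (h :+ C :+ con 1ℚ :+ con 1ℚ) :- (h :+ C :+ con 1ℚ) :* X) :* (X :- X :* Y :- Y))
              refl h C X Y ⟩
    slack + k * (X - X * Y - Y)
      ≡⟨ cong (λ t → slack + k * t) recip-relation ⟩
    slack + k * 0ℚ
      ≡⟨ solve 2 (λ w k → w :+ k :* con 0ℚ := w) refl slack k ⟩
    slack ∎)
  (nonneg-+ (nonneg-* (nonneg-* (nonneg-* h+c+1-nonneg (recip-nonneg (suc n))) (recip-nonneg (suc (suc n)))) 1-X-nonneg)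
            (nonneg-* (nonneg-* (recip-nonneg (suc n)) (recip-nonneg (suc n))) 1-X-nonneg))
  where
  open ≡-Reasoning
  h = H 1 n
  C = nat c
  X = recip (suc n)
  Y = recip (suc (suc n))
  k = (1ℚ + 1ℚ) * (h + C + 1ℚ + 1ℚ) - (h + C + 1ℚ) * X
  slack = (h + C + 1ℚ) * X * Y * (1ℚ - X) + X * X * (1ℚ - X)
  recip-relation : X - X * Y - Y ≡ 0ℚ
  recip-relation = trans (cong (λ t → t - X * Y - Y) (recip-step n))
                         (solve 2 (λ p q → p :+ q :- p :- q := con 0ℚ) refl (X * Y) Y)
  1-X-nonneg : 0ℚ ≤q 1ℚ - X
  1-X-nonneg = diff-nonneg (recip≤1 n)
  h+c+1-nonneg : 0ℚ ≤q h + C + 1ℚ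
  h+c+1-nonneg = nonneg-+ (nonneg-+ (H-nonneg 1 n) (nat-nonneg c)) 0≤1

-- At N = K + K² with K ≥ c + 2:  G_c(N) ≤ 2 (2K + K)/K² = 6/K.
majorant-at-square : ∀ c K' → 2 ℕ.+ c ℕ.≤ suc K' →
  majorant c (suc K' ℕ.+ suc K' ℕ.* suc K') ≤q nat 6 * recip (suc K')
majorant-at-square c K' c+2≤K = begin
  (1ℚ + 1ℚ) * (H 1 N + nat (2 ℕ.+ c)) * recip (suc N)
    ≤⟨ *-mono-nonneg (nonneg-* (nonneg-+ 0≤1 0≤1) (nonneg-+ (H-nonneg 1 N) (nat-nonneg (2 ℕ.+ c))))
         (*-monoˡ-≤-nonNeg (1ℚ + 1ℚ) (+-mono-≤ (H-sublinear K') (nat-mono c+2≤K)))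
         (recip-nonneg (suc N)) (recip-beyond-square K') ⟩
  (1ℚ + 1ℚ) * (nat K + nat K + nat K) * (rK * rK)
    ≡⟨ solve 2 (λ a b → (con 1ℚ :+ con 1ℚ) :* (a :+ a :+ a) :* (b :* b) := con (nat 6) :* b :* (b :* a)) refl (nat K) rK ⟩
  nat 6 * rK * (rK * nat K)
    ≡⟨ cong (nat 6 * rK *_) (recip-inverse K') ⟩
  nat 6 * rK * 1ℚ
    ≡⟨ *-identityʳ _ ⟩
  nat 6 * rK ∎
  where
  open ≤-Reasoning
  K = suc K'
  N = K ℕ.+ K ℕ.* K
  rK = recip K

-- G_c takes arbitrarily small values: choose K = 6L with L ≥ q + 1 and
-- L ≥ c + 2, where 1/(q+1) < ε.
majorant-small : ∀ c ε → 0ℚ < ε → Σ ℕ λ N → majorant c N < ε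
majorant-small c ε 0<ε = K ℕ.+ K ℕ.* K , (begin-strict
  majorant c (K ℕ.+ K ℕ.* K) ≤⟨ majorant-at-square c (L' ℕ.+ 5 ℕ.* L) c+2≤K ⟩
  nat 6 * recip K            ≡⟨ nat-recip-cancel 5 L' ⟩
  recip L                    ≤⟨ recip-antitone (ℕP.m≤m+n q (2 ℕ.+ c)) ⟩
  recip (suc q)              <⟨ proj₂ (archimedean ε 0<ε) ⟩
  ε                          ∎)
  where
  open ≤-Reasoning
  q = proj₁ (archimedean ε 0<ε)
  L' = q ℕ.+ (2 ℕ.+ c)
  L = suc L'
  K = 6 ℕ.* L
  c+2≤K : 2 ℕ.+ c ℕ.≤ K
  c+2≤K = ℕP.≤-trans (ℕP.m≤n+m (2 ℕ.+ c) (suc q)) (ℕP.m≤m+n L (5 ℕ.* L))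

dominated-converges : ∀ c (a : ℕ → ℚ) → (∀ n → 0ℚ ≤q a (suc n)) →
  (∀ n → a (suc n) ≤q (H 1 (suc n) + nat c) * (recip (suc n) * recip (suc n))) → Converges a
dominated-converges c a a-nonneg a-≤ = Telescoping.converges a (majorant c) a-nonneg (majorant-nonneg c)
  (λ n → ≤-trans (a-≤ n) (majorant-decrement c n)) (majorant-small c)

-- The three series of the theorem converge, for exponent t + 2 ≥ 2:
-- 1/n^s ≤ (H_n + 1)/n², H_n/n^s ≤ H_n/n², and H_{n+r}/n^s ≤ (H_n + r)/n².
zeta-converges : ∀ t → Converges (zetaTerm (suc (suc t)))
zeta-converges t = dominated-converges 1 (zetaTerm (suc (suc t))) (λ n → recipPow-nonneg (suc n) (suc (suc t)))
  (λ n → ≤-trans (recipPow≤recip² n t)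
     (≤-by-diff (H 1 (suc n) * X² n) (solve 2 (λ h Y → (h :+ con 1ℚ) :* Y :- Y := h :* Y) refl (H 1 (suc n)) (X² n))
                (nonneg-* (H-nonneg 1 (suc n)) (nonneg-* (recip-nonneg (suc n)) (recip-nonneg (suc n))))))
  where
  X² : ℕ → ℚ
  X² n = recip (suc n) * recip (suc n)

euler-converges : ∀ t → Converges (eulerTerm (suc (suc t)))
euler-converges t = dominated-converges 0 (eulerTerm (suc (suc t)))
  (λ n → nonneg-* (H-nonneg 1 (suc n)) (recipPow-nonneg (suc n) (suc (suc t))))
  (λ n → subst (λ u → eulerTerm (suc (suc t)) (suc n) ≤q u * (recip (suc n) * recip (suc n)))
               (sym (+-identityʳ (H 1 (suc n))))
               (*-mono-nonneg (H-nonneg 1 (suc n)) ≤-refl (recipPow-nonneg (suc n) (suc (suc t))) (recipPow≤recip² n t)))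

lhs-converges : ∀ t r → Converges (lhsTerm (suc (suc t)) r)
lhs-converges t r = dominated-converges r (lhsTerm (suc (suc t)) r)
  (λ n → nonneg-* (H-nonneg 1 (suc n ℕ.+ r)) (recipPow-nonneg (suc n) (suc (suc t))))
  (λ n → *-mono-nonneg (H-nonneg 1 (suc n ℕ.+ r)) (H-shift-≤ (suc n) r)
                       (recipPow-nonneg (suc n) (suc (suc t))) (recipPow≤recip² n t))

∣negOnePow∣ : ∀ k → ∣ negOnePow k ∣ ≡ 1ℚ
∣negOnePow∣ zero    = refl
∣negOnePow∣ (suc k) = trans (∣-p∣≡∣p∣ (negOnePow k)) (∣negOnePow∣ k)

shiftedSum-nonneg : ∀ m r N → 0ℚ ≤q shiftedSum m r N
shiftedSum-nonneg m r N = sum1-nonneg r _ (λ k _ → nonneg-* (recipPow-nonneg (suc k) m) (H-increment-nonneg N (suc k)))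

-- S_m(r, N) ≤ r · r/(N+1), as each of its r terms is at most k/(N+1) ≤ r/(N+1).
shiftedSum-≤ : ∀ m' r N → shiftedSum (suc m') r N ≤q nat r * (nat r * recip (suc N))
shiftedSum-≤ m' r N = subst (shiftedSum (suc m') r N ≤q_) (sum1-const r (nat r * recip (suc N)))
  (sum1-mono r _ _ (λ k k<r → subst (recipPow (suc k) (suc m') * (H 1 (N ℕ.+ suc k) - H 1 N) ≤q_) (*-identityˡ _)
     (*-mono-nonneg (recipPow-nonneg (suc k) (suc m')) (recipPow≤1 k m') (H-increment-nonneg N (suc k))
        (≤-trans (H-increment-≤ N (suc k))
                 (*-monoʳ-≤-nonNeg (recip (suc N)) {{nonNegative (recip-nonneg (suc N))}} (nat-mono k<r))))))

∣defect∣≡shiftedSum : ∀ m' r N → ∣ defect (suc m') r N ∣ ≡ shiftedSum (suc m') r N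
∣defect∣≡shiftedSum m' r N = begin
  ∣ defect (suc m') r N ∣             ≡⟨ cong ∣_∣ (defect-closed-form m' r N) ⟩
  ∣ negOnePow (suc m') * S ∣          ≡⟨ ∣p*q∣≡∣p∣*∣q∣ (negOnePow (suc m')) S ⟩
  ∣ negOnePow (suc m') ∣ * ∣ S ∣      ≡⟨ cong₂ _*_ (∣negOnePow∣ (suc m')) (0≤p⇒∣p∣≡p (shiftedSum-nonneg (suc m') r N)) ⟩
  1ℚ * S                              ≡⟨ *-identityˡ S ⟩
  S                                   ∎
  where
  open ≡-Reasoning
  S = shiftedSum (suc m') r N

-- The defect tends to 0: for N ≥ N₀ = (r² + 1)(q + 1) - 1, where
-- 1/(q+1) < ε, we have |defect| ≤ r²/(N+1) ≤ (r²+1)/(N₀+1) = 1/(q+1).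
defect-tendsto0 : ∀ m' r → Tendsto0 (defect (suc m') r)
defect-tendsto0 m' r ε 0<ε = N₀ , λ N N₀≤N → begin-strict
  ∣ defect (suc m') r N ∣                ≡⟨ ∣defect∣≡shiftedSum m' r N ⟩
  shiftedSum (suc m') r N               ≤⟨ shiftedSum-≤ m' r N ⟩
  nat r * (nat r * recip (suc N))       ≡⟨ trans (sym (*-assoc (nat r) (nat r) _)) (cong (_* recip (suc N)) (sym (nat-* r r))) ⟩
  nat (r ℕ.* r) * recip (suc N)         ≤⟨ *-mono-nonneg (nat-nonneg (r ℕ.* r)) (nat-mono (ℕP.n≤1+n (r ℕ.* r)))
                                                         (recip-nonneg (suc N)) (recip-antitone N₀≤N) ⟩
  nat (suc (r ℕ.* r)) * recip (suc N₀)  ≡⟨ nat-recip-cancel (r ℕ.* r) q ⟩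
  recip (suc q)                         <⟨ proj₂ (archimedean ε 0<ε) ⟩
  ε                                     ∎
  where
  open ≤-Reasoning
  q = proj₁ (archimedean ε 0<ε)
  N₀ = q ℕ.+ (r ℕ.* r) ℕ.* suc q

-- Theorem 7: for m ≥ 2 the three series converge and the defect tends to
-- 0, i.e. the stated identity holds between the sums of the series.
mainTheorem7 : (m r : ℕ) → 2 ≤ m →
    Converges (lhsTerm m r) × Converges (eulerTerm m)
    × ((s : ℕ) → 2 ≤ s → Converges (zetaTerm s))
    × Tendsto0 (defect m r)
mainTheorem7 (suc (suc t)) r (s≤s (s≤s z≤n)) =
  lhs-converges t r , euler-converges t , zetas-converge , defect-tendsto0 (suc t) r
  where
  zetas-converge : (s : ℕ) → 2 ≤ s → Converges (zetaTerm s)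
  zetas-converge (suc (suc u)) (s≤s (s≤s z≤n)) = zeta-converges u
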